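{- Let $n\ge1$ and let $q$ be a product of $k\ge1$ pairwise distinct primes. Then $\mathrm{DI}(\mathbf{GT}_n,q)=\lceil n/k\rceil$. In particular, for prime $q$, $\mathrm{DI}(\mathbf{GT}_n,q)=n$.
   Context: For a predicate $P:\mathcal X\times\mathcal Y\to\{0,1\}$ (finite sets) and integer $q\ge2$, an inner product encoding of $P$ modulo $q$ of length $\ell$ is a pair of maps $x\mapsto \vec x\in\mathbb Z_q^\ell$, $y\mapsto\vec y\in\mathbb Z_q^\ell$ such that for all $x,y$: $P(x,y)=1$ iff $\sum_{i=1}^\ell\vec x_i\vec y_i\equiv0\pmod q$; $\mathrm{DI}(P,q)$ is the minimum such $\ell$. The greater-than predicate $\mathbf{GT}_n:[n]\times[n]\to\{0,1\}$ is $\mathbf{GT}_n(x,y)=1$ iff $x>y$. -}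

module Defs where

open import Data.Nat using (ℕ; _<ᵇ_; _+_; _*_; _∸_; _<_; _≤_; NonZero)
open import Data.Nat.DivMod using (_/_; _%_)
open import Data.Nat.Primality using (Prime)
open import Data.Nat.ListAction using (product)
open import Data.Fin using (Fin; toℕ; zero; suc)
open import Data.Nat.Divisibility using (_∣_)
open import Data.Bool using (Bool; true; false)
open import Data.List using (List; length)
open import Data.List.Relation.Unary.All using (All)
open import Data.List.Relation.Unary.Unique.Propositional using (Unique)
open import Data.Product using (Σ; _×_; ∃)
open import Relation.Binary.PropositionalEquality using (_≡_)
open import Function.Bundles using (_⇔_)

-- Elements of ℤ_q are represented by Fin q; vectors of length ℓ by Fin ℓ → Fin q.
ZqVec : ℕ → ℕ → Set
ZqVec q ℓ = Fin ℓ → Fin q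

sumFin : (ℓ : ℕ) → (Fin ℓ → ℕ) → ℕ
sumFin ℕ.zero    f = 0
sumFin (ℕ.suc ℓ) f = f zero + sumFin ℓ (λ i → f (suc i))

-- inner product of two ℤ_q vectors, computed in ℕ (then reduced mod q below)
ip : {q ℓ : ℕ} → ZqVec q ℓ → ZqVec q ℓ → ℕ
ip {q} {ℓ} u v = sumFin ℓ (λ i → toℕ (u i) * toℕ (v i))

_≡0mod_ : ℕ → (q : ℕ) → Set
m ≡0mod q = q ∣ m

IPEncoding : {X Y : Set} → (X → Y → Bool) → (q ℓ : ℕ) → Set
IPEncoding {X} {Y} P q ℓ =
  Σ (X → ZqVec q ℓ) λ ex → Σ (Y → ZqVec q ℓ) λ ey →
    ∀ x y → (P x y ≡ true) ⇔ (ip (ex x) (ey y) ≡0mod q)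

DIis : {X Y : Set} → (X → Y → Bool) → (q d : ℕ) → Set
DIis P q d = IPEncoding P q d × (∀ ℓ → IPEncoding P q ℓ → d ≤ ℓ)

-- [n] = {1,…,n} represented by Fin n (i ↦ i+1, order preserving)
GT : (n : ℕ) → Fin n → Fin n → Bool
GT n x y = toℕ y <ᵇ toℕ x

ProductOfDistinctPrimes : (q k : ℕ) → Set
ProductOfDistinctPrimes q k =
  Σ (List ℕ) λ ps → (length ps ≡ k) × All Prime ps × Unique ps × (product ps ≡ q)

ceilDiv : (n k : ℕ) → .{{NonZero k}} → ℕ
ceilDiv n k = (n + k ∸ 1) / k

-- Lower bound: given an encoding x ↦ x⃗, y ↦ y⃗ of length ℓ, GT(a, a) = 0 gives a prime
-- p_i ∣ q with p_i ∤ ⟨a⃗, a⃗⟩; colour a by i.  On one colour class the matrix ⟨a⃗, b⃗⟩ is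
-- lower triangular modulo p_i with non-zero diagonal, so (Gaussian elimination over ℤ/p_i)
-- the class has at most ℓ elements, and n ≤ kℓ.
-- Upper bound: with m = ⌈n/k⌉ write x = r + a m (r < m, a < k) and encode
-- x⃗ = (∏_{s < a} p_s) e_r and y⃗_t = ∏_{s : y < t + s m} p_s.  Then q ∣ ⟨x⃗, y⃗⟩ iff every
-- p_s divides one of the two products, which happens exactly when y < r + a m = x.

module Submission where

open import Defs
import Algebra.Properties.Semiring.Sum as SemiringSum
open import Data.Bool using (true; if_then_else_)
open import Data.Bool.Properties using (T-≡)
open import Data.Fin using (Fin; zero; suc; toℕ; fromℕ<; _≟_)
open import Data.Fin.Properties using (¬∀⟶∃¬; punchInᵢ≢i; suc-injective; toℕ-fromℕ<; toℕ<n)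
open import Data.List using (List; []; _∷_; length; lookup)
open import Data.List.Membership.Propositional.Properties using (∈-lookup)
import Data.List.Relation.Unary.All as All
open import Data.List.Relation.Unary.Unique.Propositional using (Unique; []; _∷_)
open import Data.Nat using (ℕ; zero; suc; _≤_; _<_; z≤n; s≤s; NonZero; >-nonZero; >-nonZero⁻¹)
import Data.Nat as ℕ
import Data.Nat.Divisibility as ℕ
open import Data.Nat.DivMod
  using (_/_; _%_; _mod_; _divMod_; DivMod; m%n<n; m≡m%n+[m/n]*n; %-distribˡ-*; m*n%n≡0; m<n*o⇒m/o<n; m<n⇒m/n≡0; n/1≡n)
open import Data.Nat.ListAction using (product)
open import Data.Nat.Primality using (Prime; euclidsLemma; prime⇒irreducible; ¬prime[1]; prime⇒nonZero)
open import Data.Nat.Properties hiding (_≟_; suc-injective)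
import Data.Product as Product
open import Data.Product using (∃; _×_; _,_; proj₁; proj₂)
open import Data.Sum using (_⊎_; inj₁; inj₂; [_,_]′)
open import Data.Vec.Functional using (removeAt)
open import Function using (_∘_; id; _⇔_; mk⇔; Injective)
open import Function.Bundles using (Equivalence)
open import Function.Properties.Equivalence using (⇔-setoid) renaming (sym to ⇔-sym; trans to ⇔-trans)
open import Level using (0ℓ)
import Relation.Binary.Reasoning.Setoid as SetoidReasoning
open import Relation.Binary.PropositionalEquality
open import Relation.Nullary using (¬_; Dec; yes; no; does; contradiction)
open import Relation.Nullary.Decidable using (dec-true; dec-false)
open import Relation.Unary using (Decidable)

open import Algebra.Properties.Monoid.Sum *-1-monoid using () renaming (sum to ∏)
open SemiringSum +-*-semiring using (sum; sum-syntax; ∑-comm; sum-remove; sum-cong-≗; sum-replicate-zero)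
open Equivalence

indicator : ∀ {A : Set} → Dec A → ℕ
indicator A? = if does A? then 1 else 0

count : ∀ {n} {P : Fin n → Set} → Decidable P → ℕ
count P? = sum (indicator ∘ P?)

module Elimination where

  open import Data.Integer using (ℤ; +_; _+_; _-_; _*_; -_; ∣_∣)
  import Data.Integer.Properties as ℤ
  open import Data.Integer.Divisibility.Signed
    using (_∣_; _∣?_; ∣ᵤ⇒∣; ∣⇒∣ᵤ; ∣m∣n⇒∣m+n; ∣m∣n⇒∣m-n; ∣m+n∣n⇒∣m; ∣m⇒∣-m; ∣n⇒∣m*n)
  open import Data.Integer.Tactic.RingSolver using (solve-∀)
  module ℤΣ = SemiringSum ℤ.+-*-semiring

  infix 7 _·_
  _·_ : ∀ {ℓ} → (Fin ℓ → ℤ) → (Fin ℓ → ℤ) → ℤ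
  u · v = ℤΣ.sum (λ t → u t * v t)

  sum-linear : ∀ {ℓ} a b (f g : Fin ℓ → ℤ) → ℤΣ.sum (λ t → a * f t - b * g t) ≡ a * ℤΣ.sum f - b * ℤΣ.sum g
  sum-linear a b f g = begin
    ℤΣ.sum (λ t → a * f t - b * g t)              ≡⟨ ℤΣ.∑-distrib-+ (λ t → a * f t) (λ t → - (b * g t)) ⟩
    ℤΣ.sum (λ t → a * f t) + ℤΣ.sum (λ t → - (b * g t))
      ≡⟨ cong₂ _+_ (sym (ℤΣ.*-distribˡ-sum a f)) (ℤΣ.sum-cong-≗ (λ t → ℤ.neg-distribˡ-* b (g t))) ⟩
    a * ℤΣ.sum f + ℤΣ.sum (λ t → - b * g t)         ≡⟨ cong (λ z → a * ℤΣ.sum f + z) (sym (ℤΣ.*-distribˡ-sum (- b) g)) ⟩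
    a * ℤΣ.sum f + - b * ℤΣ.sum g                    ≡⟨ cong (λ z → a * ℤΣ.sum f + z) (sym (ℤ.neg-distribˡ-* b (ℤΣ.sum g))) ⟩
    a * ℤΣ.sum f - b * ℤΣ.sum g                      ∎
    where open ≡-Reasoning

  ·-linearʳ : ∀ {ℓ} a b (u v w : Fin ℓ → ℤ) → u · (λ t → a * v t - b * w t) ≡ a * (u · v) - b * (u · w)
  ·-linearʳ a b u v w = trans (ℤΣ.sum-cong-≗ (λ t → distrib a b (u t) (v t) (w t)))
                              (sum-linear a b (λ t → u t * v t) (λ t → u t * w t))
    where
    distrib : ∀ a b x y z → x * (a * y - b * z) ≡ a * (x * y) - b * (x * z)
    distrib = solve-∀

  ·-removeAt : ∀ {ℓ} (u v : Fin (suc ℓ) → ℤ) j → v j ≡ + 0 → u · v ≡ removeAt u j · removeAt v j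
  ·-removeAt u v j vj≡0 = begin
    u · v                                        ≡⟨ ℤΣ.sum-remove {i = j} (λ t → u t * v t) ⟩
    u j * v j + removeAt u j · removeAt v j      ≡⟨ cong (λ z → u j * z + removeAt u j · removeAt v j) vj≡0 ⟩
    u j * + 0 + removeAt u j · removeAt v j      ≡⟨ cong (_+ removeAt u j · removeAt v j) (ℤ.*-zeroʳ (u j)) ⟩
    + 0 + removeAt u j · removeAt v j            ≡⟨ ℤ.+-identityˡ _ ⟩
    removeAt u j · removeAt v j                  ∎
    where open ≡-Reasoning

  ∣-sum : ∀ {ℓ d} (f : Fin ℓ → ℤ) → (∀ t → d ∣ f t) → d ∣ ℤΣ.sum f
  ∣-sum {zero}  f d∣f = ∣ᵤ⇒∣ (ℕ._∣0 _)
  ∣-sum {suc ℓ} f d∣f = ∣m∣n⇒∣m+n (d∣f zero) (∣-sum (f ∘ suc) (d∣f ∘ suc))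

  ∤·⇒∃∤ : ∀ {ℓ d} (u v : Fin ℓ → ℤ) → ¬ d ∣ u · v → ∃ λ t → ¬ d ∣ v t
  ∤·⇒∃∤ {ℓ} {d} u v d∤u·v =
    ¬∀⟶∃¬ ℓ _ (λ t → d ∣? v t) (λ d∣v → d∤u·v (∣-sum _ (λ t → ∣n⇒∣m*n (u t) (d∣v t))))

  embed : ∀ {q ℓ} → ZqVec q ℓ → Fin ℓ → ℤ
  embed x t = + toℕ (x t)

  ip≡· : ∀ {q ℓ} (x y : ZqVec q ℓ) → + ip x y ≡ embed x · embed y
  ip≡· {ℓ = zero}  x y = refl
  ip≡· {ℓ = suc ℓ} x y = begin
    + (toℕ (x zero) ℕ.* toℕ (y zero) ℕ.+ ip (x ∘ suc) (y ∘ suc))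
      ≡⟨ ℤ.pos-+ (toℕ (x zero) ℕ.* toℕ (y zero)) (ip (x ∘ suc) (y ∘ suc)) ⟩
    + (toℕ (x zero) ℕ.* toℕ (y zero)) + + ip (x ∘ suc) (y ∘ suc)
      ≡⟨ cong₂ _+_ (ℤ.pos-* (toℕ (x zero)) (toℕ (y zero))) (ip≡· (x ∘ suc) (y ∘ suc)) ⟩
    embed x · embed y ∎
    where open ≡-Reasoning

  module _ (p : ℕ) (p-prime : Prime p) where

    ∤*∤⇒∤* : ∀ {a b} → ¬ + p ∣ a → ¬ + p ∣ b → ¬ + p ∣ a * b
    ∤*∤⇒∤* {a} {b} p∤a p∤b p∣ab with euclidsLemma ∣ a ∣ ∣ b ∣ p-prime (subst (p ℕ.∣_) (ℤ.abs-* a b) (∣⇒∣ᵤ p∣ab))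
    ... | inj₁ p∣a = p∤a (∣ᵤ⇒∣ p∣a)
    ... | inj₂ p∣b = p∤b (∣ᵤ⇒∣ p∣b)

    record Triangular {n ℓ} (P : Fin n → Set) (u v : Fin n → Fin ℓ → ℤ) : Set where
      field
        below    : ∀ {a b} → toℕ b < toℕ a → P a → P b → + p ∣ u a · v b
        diagonal : ∀ {a} → P a → ¬ + p ∣ u a · v a
    open Triangular

    triangular-tail : ∀ {n ℓ} {P : Fin (suc n) → Set} {u v : Fin (suc n) → Fin ℓ → ℤ} →
                      Triangular P u v → Triangular (P ∘ suc) (u ∘ suc) (v ∘ suc)
    triangular-tail tri = record { below = λ b<a → below tri (s≤s b<a) ; diagonal = diagonal tri }

    -- v b ↦ (v zero j) v b − (v b j) v zero clears coordinate j and, as u a · v zero ≡ 0 (mod p),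
    -- only multiplies u a · v b by the unit v zero j modulo p; dropping j lowers the dimension.
    triangular-pivot : ∀ {n ℓ} {P : Fin (suc n) → Set} {u v : Fin (suc n) → Fin (suc ℓ) → ℤ} →
                       Triangular P u v → P zero → ∀ j → ¬ + p ∣ v zero j →
                       Triangular (P ∘ suc) (λ a → removeAt (u (suc a)) j)
                                            (λ b → removeAt (λ t → v zero j * v (suc b) t - v (suc b) j * v zero t) j)
    triangular-pivot {P = P} {u} {v} tri P0 j p∤w = record
      { below    = λ {a} {b} b<a Pa Pb → subst (+ p ∣_) (sym (reduced a b))
                     (∣m∣n⇒∣m-n (∣n⇒∣m*n w (below tri (s≤s b<a) Pa Pb)) (∣n⇒∣m*n (v (suc b) j) (p∣u·v₀ Pa)))
      ; diagonal = λ {a} Pa p∣ → ∤*∤⇒∤* p∤w (diagonal tri Pa)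
                     (∣m+n∣n⇒∣m (subst (+ p ∣_) (reduced a a) p∣) (∣m⇒∣-m (∣n⇒∣m*n (v (suc a) j) (p∣u·v₀ Pa))))
      }
      where
      w = v zero j
      p∣u·v₀ : ∀ {a} → P (suc a) → + p ∣ u (suc a) · v zero
      p∣u·v₀ Pa = below tri (s≤s z≤n) Pa P0
      v′ : Fin _ → Fin _ → ℤ
      v′ b t = w * v (suc b) t - v (suc b) j * v zero t
      cleared : ∀ b → v′ b j ≡ + 0
      cleared b = vanish w (v (suc b) j)
        where
        vanish : ∀ x y → x * y - y * x ≡ + 0
        vanish = solve-∀
      reduced : ∀ a b → removeAt (u (suc a)) j · removeAt (v′ b) j
                        ≡ w * (u (suc a) · v (suc b)) - v (suc b) j * (u (suc a) · v zero)
      reduced a b = trans (sym (·-removeAt (u (suc a)) (v′ b) j (cleared b)))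
                          (·-linearʳ w (v (suc b) j) (u (suc a)) (v (suc b)) (v zero))

    triangular⇒count≤ : ∀ {n ℓ} {P : Fin n → Set} (P? : Decidable P) {u v : Fin n → Fin ℓ → ℤ} →
                        Triangular P u v → count P? ≤ ℓ
    triangular⇒count≤ {zero}  P? tri = z≤n
    triangular⇒count≤ {suc n} P? {u} {v} tri with P? zero
    ... | no _ = triangular⇒count≤ (P? ∘ suc) (triangular-tail tri)
    ... | yes P0 with ∤·⇒∃∤ (u zero) (v zero) (diagonal tri P0)
    triangular⇒count≤ {suc n} {zero}  P? tri | yes P0 | () , _
    triangular⇒count≤ {suc n} {suc ℓ} P? tri | yes P0 | j , p∤w =
      s≤s (triangular⇒count≤ (P? ∘ suc) (triangular-pivot tri P0 j p∤w))

    ip-triangular⇒count≤ : ∀ {n q ℓ} {P : Fin n → Set} (P? : Decidable P) (x y : Fin n → ZqVec q ℓ) →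
      (∀ {a b} → toℕ b < toℕ a → P a → P b → p ℕ.∣ ip (x a) (y b)) →
      (∀ {a} → P a → ¬ p ℕ.∣ ip (x a) (y a)) →
      count P? ≤ ℓ
    ip-triangular⇒count≤ P? x y p∣below p∤diagonal = triangular⇒count≤ P? {embed ∘ x} {embed ∘ y} record
      { below    = λ {a} {b} b<a Pa Pb → subst (+ p ∣_) (ip≡· (x a) (y b)) (∣ᵤ⇒∣ (p∣below b<a Pa Pb))
      ; diagonal = λ {a} Pa p∣ → p∤diagonal Pa (∣⇒∣ᵤ (subst (+ p ∣_) (sym (ip≡· (x a) (y a))) p∣))
      }

open Elimination using (ip-triangular⇒count≤)
open import Data.Nat using (_+_; _*_; _∸_)
open import Data.Nat.Divisibility
  using (_∣_; divides; _∣?_; ∣-trans; ∣-refl; ∣1⇒≡1; 1∣_; m∣m*n; ∣n⇒∣m*n; ∣m⇒∣m*n; *-pres-∣; m%n≡0⇒n∣m; n∣m⇒m%n≡0)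

∑-const : ∀ n c → ∑[ i < n ] c ≡ n * c
∑-const zero    c = refl
∑-const (suc n) c = cong (c +_) (∑-const n c)

∑-mono-≤ : ∀ {n} {f g : Fin n → ℕ} → (∀ i → f i ≤ g i) → sum f ≤ sum g
∑-mono-≤ {zero}  f≤g = z≤n
∑-mono-≤ {suc n} f≤g = +-mono-≤ (f≤g zero) (∑-mono-≤ (f≤g ∘ suc))

sum-single : ∀ {n} (f : Fin n → ℕ) j → (∀ i → i ≢ j → f i ≡ 0) → sum f ≡ f j
sum-single {suc n} f j f≡0 = begin
  sum f                     ≡⟨ sum-remove {i = j} f ⟩
  f j + sum (removeAt f j)  ≡⟨ cong (f j +_) (trans (sum-cong-≗ (λ i → f≡0 _ (punchInᵢ≢i j i))) (sum-replicate-zero n)) ⟩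
  f j + 0                   ≡⟨ +-identityʳ (f j) ⟩
  f j                       ∎
  where open ≡-Reasoning

sumFin≡sum : ∀ n (f : Fin n → ℕ) → sumFin n f ≡ sum f
sumFin≡sum zero    f = refl
sumFin≡sum (suc n) f = cong (f zero +_) (sumFin≡sum n (f ∘ suc))

indicator-sum : ∀ {k} (j : Fin k) → ∑[ i < k ] indicator (j ≟ i) ≡ 1
indicator-sum j = trans (sum-single _ j (λ i i≢j → cong (if_then 1 else 0) (dec-false (j ≟ i) (i≢j ∘ sym))))
                        (cong (if_then 1 else 0) (dec-true (j ≟ j) refl))

colouring-bound : ∀ {n k ℓ} (colour : Fin n → Fin k) → (∀ i → count (λ a → colour a ≟ i) ≤ ℓ) → n ≤ k * ℓ
colouring-bound {n} {k} {ℓ} colour class≤ℓ = begin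
  n                                                              ≡⟨ sym (trans (∑-const n 1) (*-identityʳ n)) ⟩
  ∑[ a < n ] 1                                                   ≡⟨ sum-cong-≗ (λ a → sym (indicator-sum (colour a))) ⟩
  ∑[ a < n ] ∑[ i < k ] indicator (colour a ≟ i)                 ≡⟨ ∑-comm (λ a i → indicator (colour a ≟ i)) ⟩
  ∑[ i < k ] count (λ a → colour a ≟ i)                          ≤⟨ ∑-mono-≤ class≤ℓ ⟩
  ∑[ i < k ] ℓ                                                   ≡⟨ ∑-const k ℓ ⟩
  k * ℓ                                                          ∎
  where open ≤-Reasoning

n≤⌈n/k⌉*k : ∀ n k .{{_ : NonZero k}} → n ≤ ceilDiv n k * k
n≤⌈n/k⌉*k zero    k = z≤n
n≤⌈n/k⌉*k (suc n) k = +-cancelʳ-≤ k (suc n) ((n + k) / k * k) (begin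
  suc (n + k)                          ≡⟨ cong suc (m≡m%n+[m/n]*n (n + k) k) ⟩
  suc ((n + k) % k + (n + k) / k * k)  ≤⟨ +-monoˡ-≤ ((n + k) / k * k) (m%n<n (n + k) k) ⟩
  k + (n + k) / k * k                  ≡⟨ +-comm k _ ⟩
  (n + k) / k * k + k                  ∎)
  where open ≤-Reasoning

⌈n/k⌉≤ : ∀ {n k ℓ} .{{_ : NonZero k}} → n ≤ k * ℓ → ceilDiv n k ≤ ℓ
⌈n/k⌉≤ {zero}  {k} {ℓ} _ = subst (_≤ ℓ) (sym (m<n⇒m/n≡0 (∸-monoʳ-< (s≤s z≤n) (>-nonZero⁻¹ k)))) z≤n
⌈n/k⌉≤ {suc n} {k} {ℓ} n<kℓ = ≤-pred (m<n*o⇒m/o<n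
  (subst (suc (n + k) ≤_) (+-comm (ℓ * k) k) (+-monoˡ-≤ k (subst (suc n ≤_) (*-comm k ℓ) n<kℓ))))

⌈n/1⌉≡n : ∀ n → ceilDiv n 1 ≡ n
⌈n/1⌉≡n n = trans (n/1≡n (n + 1 ∸ 1)) (m+n∸n≡m n 1)

GT⇔< : ∀ {n} (x y : Fin n) → (GT n x y ≡ true) ⇔ toℕ y < toℕ x
GT⇔< x y = ⇔-trans (⇔-sym T-≡) (mk⇔ (<ᵇ⇒< (toℕ y) (toℕ x)) <⇒<ᵇ)

block-cover : ∀ {k m a r y} → a < k → (∀ (s : Fin k) → toℕ s < a ⊎ y < r + toℕ s * m) ⇔ y < r + a * m
block-cover {k} {m} {a} {r} {y} a<k = mk⇔ to′ from′
  where
  to′ : (∀ (s : Fin k) → toℕ s < a ⊎ y < r + toℕ s * m) → y < r + a * m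
  to′ cover with cover (fromℕ< a<k)
  ... | inj₁ a<a = contradiction (subst (_< a) (toℕ-fromℕ< a<k) a<a) (<-irrefl refl)
  ... | inj₂ y<  = subst (λ b → y < r + b * m) (toℕ-fromℕ< a<k) y<
  from′ : y < r + a * m → ∀ (s : Fin k) → toℕ s < a ⊎ y < r + toℕ s * m
  from′ y< s with toℕ s <? a
  ... | yes s<a = inj₁ s<a
  ... | no  s≮a = inj₂ (<-≤-trans y< (+-monoʳ-≤ r (*-monoˡ-≤ m (≮⇒≥ s≮a))))

∣mod*mod⇔∣* : ∀ a b d .{{_ : NonZero d}} → d ∣ toℕ (a mod d) * toℕ (b mod d) ⇔ d ∣ a * b
∣mod*mod⇔∣* a b d rewrite toℕ-fromℕ< (m%n<n a d) | toℕ-fromℕ< (m%n<n b d) = mk⇔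
  (λ d∣ → m%n≡0⇒n∣m _ d (trans (%-distribˡ-* a b d) (n∣m⇒m%n≡0 _ d d∣)))
  (λ d∣ → m%n≡0⇒n∣m _ d (trans (sym (%-distribˡ-* a b d)) (n∣m⇒m%n≡0 _ d d∣)))

∣-∏ : ∀ {k} (f : Fin k → ℕ) s → f s ∣ ∏ f
∣-∏ f zero    = m∣m*n _
∣-∏ f (suc s) = ∣n⇒∣m*n (f zero) (∣-∏ (f ∘ suc) s)

∏-nonZero : ∀ {k} {f : Fin k → ℕ} → (∀ s → NonZero (f s)) → NonZero (∏ f)
∏-nonZero {zero}  f≢0 = _
∏-nonZero {suc k} f≢0 = m*n≢0 _ _ {{f≢0 zero}} {{∏-nonZero (f≢0 ∘ suc)}}

prime∣∏⇒∣factor : ∀ {k r} (f : Fin k → ℕ) → Prime r → r ∣ ∏ f → ∃ λ s → r ∣ f s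
prime∣∏⇒∣factor {zero}  f r-prime r∣1 = contradiction (subst Prime (∣1⇒≡1 r∣1) r-prime) ¬prime[1]
prime∣∏⇒∣factor {suc k} f r-prime r∣∏ with euclidsLemma (f zero) (∏ (f ∘ suc)) r-prime r∣∏
... | inj₁ r∣f₀ = zero , r∣f₀
... | inj₂ r∣∏tail = Product.map suc id (prime∣∏⇒∣factor (f ∘ suc) r-prime r∣∏tail)

prime∣prime⇒≡ : ∀ {a b} → Prime a → Prime b → a ∣ b → a ≡ b
prime∣prime⇒≡ a-prime b-prime a∣b with prime⇒irreducible b-prime a∣b
... | inj₁ a≡1 = contradiction (subst Prime a≡1 a-prime) ¬prime[1]
... | inj₂ a≡b = a≡b

primes∣⇒∏∣ : ∀ {k m} {p : Fin k → ℕ} → (∀ s → Prime (p s)) → Injective _≡_ _≡_ p → (∀ s → p s ∣ m) → ∏ p ∣ m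
primes∣⇒∏∣ {zero}  {m} _ _ _ = 1∣ m
primes∣⇒∏∣ {suc k} {m} {p} p-prime p-injective p∣m
  with primes∣⇒∏∣ (p-prime ∘ suc) (suc-injective ∘ p-injective) (p∣m ∘ suc)
... | divides c m≡c*∏tail
  with euclidsLemma c (∏ (p ∘ suc)) (p-prime zero) (subst (p zero ∣_) m≡c*∏tail (p∣m zero))
...   | inj₁ p₀∣c = subst (∏ p ∣_) (sym m≡c*∏tail) (*-pres-∣ p₀∣c ∣-refl)
...   | inj₂ p₀∣∏tail with prime∣∏⇒∣factor (p ∘ suc) (p-prime zero) p₀∣∏tail
...     | s , p₀∣pₛ with p-injective (prime∣prime⇒≡ (p-prime zero) (p-prime (suc s)) p₀∣pₛ)
...       | ()

module _ {k} {p : Fin k → ℕ} (p-prime : ∀ s → Prime (p s)) (p-injective : Injective _≡_ _≡_ p) where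

  ∏∣⇔∀∣ : ∀ {m} → ∏ p ∣ m ⇔ (∀ s → p s ∣ m)
  ∏∣⇔∀∣ = mk⇔ (λ ∏∣m s → ∣-trans (∣-∏ p s) ∏∣m) (primes∣⇒∏∣ p-prime p-injective)

  ∏∤⇒∃∤ : ∀ {m} → ¬ ∏ p ∣ m → ∃ λ s → ¬ p s ∣ m
  ∏∤⇒∃∤ {m} ∏∤m = ¬∀⟶∃¬ k _ (λ s → p s ∣? m) (∏∤m ∘ from ∏∣⇔∀∣)

  select : {P : Fin k → Set} → Decidable P → Fin k → ℕ
  select P? s = if does (P? s) then p s else 1

  ∣∏select⇔ : ∀ {P : Fin k → Set} (P? : Decidable P) s → p s ∣ ∏ (select P?) ⇔ P s
  ∣∏select⇔ {P} P? s = mk⇔ to′ from′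
    where
    to′ : p s ∣ ∏ (select P?) → P s
    to′ pₛ∣∏ with prime∣∏⇒∣factor (select P?) (p-prime s) pₛ∣∏
    ... | t , pₛ∣ with P? t
    ...   | yes Pt = subst P (sym (p-injective (prime∣prime⇒≡ (p-prime s) (p-prime t) pₛ∣))) Pt
    ...   | no _   = contradiction (subst Prime (∣1⇒≡1 pₛ∣) (p-prime s)) ¬prime[1]
    from′ : P s → p s ∣ ∏ (select P?)
    from′ Ps with P? s | ∣-∏ (select P?) s
    ... | yes _  | sel∣∏ = sel∣∏
    ... | no ¬Ps | _     = contradiction Ps ¬Ps

  ∏∣select*select⇔ : ∀ {P R : Fin k → Set} (P? : Decidable P) (R? : Decidable R) →
                     ∏ p ∣ ∏ (select P?) * ∏ (select R?) ⇔ (∀ s → P s ⊎ R s)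
  ∏∣select*select⇔ {P} {R} P? R? = ⇔-trans ∏∣⇔∀∣ (mk⇔ (λ p∣ s → cover s (p∣ s)) (λ P∪R s → uncover s (P∪R s)))
    where
    cover : ∀ s → p s ∣ ∏ (select P?) * ∏ (select R?) → P s ⊎ R s
    cover s pₛ∣ = [ inj₁ ∘ to (∣∏select⇔ P? s) , inj₂ ∘ to (∣∏select⇔ R? s) ]′
                    (euclidsLemma (∏ (select P?)) (∏ (select R?)) (p-prime s) pₛ∣)
    uncover : ∀ s → P s ⊎ R s → p s ∣ ∏ (select P?) * ∏ (select R?)
    uncover s = [ ∣m⇒∣m*n (∏ (select R?)) ∘ from (∣∏select⇔ P? s)
                , ∣n⇒∣m*n (∏ (select P?)) ∘ from (∣∏select⇔ R? s) ]′

  encoding⇒n≤k*ℓ : ∀ {n ℓ} → IPEncoding (GT n) (∏ p) ℓ → n ≤ k * ℓ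
  encoding⇒n≤k*ℓ {n} {ℓ} (x , y , encodes) = colouring-bound colour class≤ℓ
    where
    spec : ∀ a b → toℕ b < toℕ a ⇔ ∏ p ∣ ip (x a) (y b)
    spec a b = ⇔-trans (⇔-sym (GT⇔< a b)) (encodes a b)
    ∏∤diagonal : ∀ a → ¬ ∏ p ∣ ip (x a) (y a)
    ∏∤diagonal a = <-irrefl refl ∘ from (spec a a)
    colour : Fin n → Fin k
    colour a = proj₁ (∏∤⇒∃∤ (∏∤diagonal a))
    class≤ℓ : ∀ i → count (λ a → colour a ≟ i) ≤ ℓ
    class≤ℓ i = ip-triangular⇒count≤ (p i) (p-prime i) (λ a → colour a ≟ i) x y
      (λ {a} {b} b<a _ _ → ∣-trans (∣-∏ p i) (to (spec a b) b<a))
      (λ {a} → λ { refl → proj₂ (∏∤⇒∃∤ (∏∤diagonal a)) })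

  GT-encoding : ∀ {n m} .{{_ : NonZero m}} → n ≤ m * k → IPEncoding (GT n) (∏ p) m
  GT-encoding {n} {m} n≤mk = encodeˣ , encodeʸ , λ x y → ⇔-trans (GT⇔< x y) (⇔-sym (spec x y))
    where
    instance
      ∏p≢0 : NonZero (∏ p)
      ∏p≢0 = ∏-nonZero (prime⇒nonZero ∘ p-prime)
    q = ∏ p
    block : Fin n → ℕ
    block x = toℕ x / m
    offset : Fin n → Fin m
    offset x = toℕ x mod m
    block<k : ∀ x → block x < k
    block<k x = m<n*o⇒m/o<n (<-≤-trans (toℕ<n x) (subst (n ≤_) (*-comm m k) n≤mk))
    A : Fin n → ℕ
    A x = ∏ (select (λ s → toℕ s <? block x))
    B : Fin n → Fin m → ℕ
    B y t = ∏ (select (λ s → toℕ y <? toℕ t + toℕ s * m))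
    encodeˣ encodeʸ : Fin n → ZqVec q m
    encodeˣ x t = (if does (t ≟ offset x) then A x else 0) mod q
    encodeʸ y t = B y t mod q
    ip-value : ∀ x y → ip (encodeˣ x) (encodeʸ y) ≡ toℕ (A x mod q) * toℕ (B y (offset x) mod q)
    ip-value x y = trans (sumFin≡sum m _) (trans (sum-single _ (offset x) vanish) at-offset)
      where
      vanish : ∀ t → t ≢ offset x → toℕ (encodeˣ x t) * toℕ (encodeʸ y t) ≡ 0
      vanish t t≢o rewrite dec-false (t ≟ offset x) t≢o | toℕ-fromℕ< (m%n<n 0 q) | m*n%n≡0 0 q {{∏p≢0}} = refl
      at-offset : toℕ (encodeˣ x (offset x)) * toℕ (encodeʸ y (offset x)) ≡ toℕ (A x mod q) * toℕ (B y (offset x) mod q)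
      at-offset rewrite dec-true (offset x ≟ offset x) refl = refl
    spec : ∀ x y → ip (encodeˣ x) (encodeʸ y) ≡0mod q ⇔ toℕ y < toℕ x
    spec x y = begin
      q ∣ ip (encodeˣ x) (encodeʸ y)                                   ≡⟨ cong (q ∣_) (ip-value x y) ⟩
      q ∣ toℕ (A x mod q) * toℕ (B y (offset x) mod q)                 ≈⟨ ∣mod*mod⇔∣* (A x) (B y (offset x)) q ⟩
      q ∣ A x * B y (offset x)
        ≈⟨ ∏∣select*select⇔ (λ s → toℕ s <? block x) (λ s → toℕ y <? toℕ (offset x) + toℕ s * m) ⟩
      (∀ s → toℕ s < block x ⊎ toℕ y < toℕ (offset x) + toℕ s * m)     ≈⟨ block-cover (block<k x) ⟩
      toℕ y < toℕ (offset x) + block x * m                             ≡⟨ cong (toℕ y <_) (sym (DivMod.property (toℕ x divMod m))) ⟩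
      toℕ y < toℕ x                                                    ∎
      where open SetoidReasoning (⇔-setoid 0ℓ)

  DI-GT : ∀ {n} .{{_ : NonZero k}} → 1 ≤ n → DIis (GT n) (∏ p) (ceilDiv n k)
  DI-GT {n} 1≤n = GT-encoding {{⌈n/k⌉≢0}} (n≤⌈n/k⌉*k n k) , λ ℓ → ⌈n/k⌉≤ ∘ encoding⇒n≤k*ℓ
    where
    ⌈n/k⌉≢0 : NonZero (ceilDiv n k)
    ⌈n/k⌉≢0 = m*n≢0⇒m≢0 (ceilDiv n k) {{>-nonZero (≤-trans 1≤n (n≤⌈n/k⌉*k n k))}}

∏-lookup : ∀ ps → ∏ (lookup ps) ≡ product ps
∏-lookup []       = refl
∏-lookup (x ∷ ps) = cong (x *_) (∏-lookup ps)

lookup-injective : ∀ {ps : List ℕ} → Unique ps → Injective _≡_ _≡_ (lookup ps)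
lookup-injective {_ ∷ _} (_   ∷ _) {zero}  {zero}  _ = refl
lookup-injective {_ ∷ _} (x∉ ∷ _) {zero}  {suc j} e = contradiction e (All.lookup x∉ (∈-lookup j))
lookup-injective {_ ∷ _} (x∉ ∷ _) {suc i} {zero}  e = contradiction (sym e) (All.lookup x∉ (∈-lookup i))
lookup-injective {_ ∷ _} (_  ∷ u) {suc i} {suc j} e = cong suc (lookup-injective u e)

mainTheorem5 : (∀ (n k q : ℕ) → 1 ≤ n → (k≥1 : 1 ≤ k) → ProductOfDistinctPrimes q k →
    DIis (GT n) q (ceilDiv n k {{>-nonZero k≥1}}))
    × (∀ (n q : ℕ) → 1 ≤ n → Prime q → DIis (GT n) q n)
mainTheorem5 = distinct-primes , prime
  where
  distinct-primes : ∀ (n k q : ℕ) → 1 ≤ n → (k≥1 : 1 ≤ k) → ProductOfDistinctPrimes q k →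
                    DIis (GT n) q (ceilDiv n k {{>-nonZero k≥1}})
  distinct-primes n _ _ 1≤n k≥1 (ps , refl , ps-prime , ps-unique , refl) =
    subst (λ q → DIis (GT n) q (ceilDiv n (length ps) {{>-nonZero k≥1}})) (∏-lookup ps)
      (DI-GT (λ s → All.lookup ps-prime (∈-lookup s)) (lookup-injective ps-unique) {{>-nonZero k≥1}} 1≤n)
  prime : ∀ (n q : ℕ) → 1 ≤ n → Prime q → DIis (GT n) q n
  prime n q 1≤n q-prime = subst (DIis (GT n) q) (⌈n/1⌉≡n n)
    (distinct-primes n 1 q 1≤n (s≤s z≤n) (q ∷ [] , refl , q-prime All.∷ All.[] , All.[] ∷ [] , *-identityʳ q))
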